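{- For all $\lambda H$-terms $U,V$ and every variable $x$, $E(U[V/x])=E(E(U)[E(V)/x])$.
   Context: $\lambda H$-terms are the $\lambda$-terms built from variables and one additional constant $H$ by abstraction and application; $U[V/x]$ denotes (capture-avoiding) substitution of $V$ for $x$ in $U$. Application is left-associative: $T\,U_1\ldots U_n$ means $(\ldots(T\,U_1)\ldots U_n)$. The map $E$ on $\lambda H$-terms is defined by induction: $E(x)=x$ for variables $x$; $E(H)=H$; $E(\lambda x\,U)=\lambda x\,E(U)$; $E(U\,V)=E(U)\,E(V)$ if $U$ is not of the form $H\,U_1\ldots U_n$ with $n\ge 0$; and $E(H\,U_1U_2\ldots U_n)=E(U_1U_2\ldots U_n)$ for $n\ge1$. -}

module Defs where

open import Data.Nat using (ℕ; zero; suc; _+_)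
open import Data.Fin using (Fin; zero; suc)
open import Data.Fin.Properties using (_≟_)
open import Data.Maybe using (Maybe; just; nothing)
open import Relation.Nullary using (yes; no)

-- λH-terms, well-scoped de Bruijn representation (terms up to α-equivalence).
-- Term n : terms whose free variables are among the n variables Fin n.
data Term (n : ℕ) : Set where
  var : Fin n → Term n
  H   : Term n
  lam : Term (suc n) → Term n
  app : Term n → Term n → Term n

ext : ∀ {n m} → (Fin n → Fin m) → Fin (suc n) → Fin (suc m)
ext ρ zero    = zero
ext ρ (suc i) = suc (ρ i)

rename : ∀ {n m} → (Fin n → Fin m) → Term n → Term m
rename ρ (var i)   = var (ρ i)
rename ρ H         = H
rename ρ (lam U)   = lam (rename (ext ρ) U)
rename ρ (app U V) = app (rename ρ U) (rename ρ V)

exts : ∀ {n m} → (Fin n → Term m) → Fin (suc n) → Term (suc m)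
exts σ zero    = var zero
exts σ (suc i) = rename suc (σ i)

subst : ∀ {n m} → (Fin n → Term m) → Term n → Term m
subst σ (var i)   = σ i
subst σ H         = H
subst σ (lam U)   = lam (subst (exts σ) U)
subst σ (app U V) = app (subst σ U) (subst σ V)

single : ∀ {n} → Fin n → Term n → Fin n → Term n
single x V y with x ≟ y
... | yes _ = V
... | no  _ = var y

_[_/_] : ∀ {n} → Term n → Term n → Fin n → Term n
U [ V / x ] = subst (single x V) U

-- stripH U = just (U₁ U₂ … Uₖ)  iff  U = H U₁ U₂ … Uₖ with k ≥ 1; nothing otherwise.
stripH : ∀ {n} → Term n → Maybe (Term n)
stripH (app H V)         = just V
stripH (app (var i) V)   = nothing
stripH (app (lam W) V)   = nothing
stripH (app (app U W) V) with stripH (app U W)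
... | just T  = just (app T V)
... | nothing = nothing
stripH (var i) = nothing
stripH H       = nothing
stripH (lam U) = nothing

size : ∀ {n} → Term n → ℕ
size (var i)   = 1
size H         = 1
size (lam U)   = suc (size U)
size (app U V) = suc (size U + size V)

-- E with fuel; each recursive call is on a term of strictly smaller size,
-- so fuel = size t always suffices (the fuel-zero clause is never reached from E).
Ef : ∀ {n} → ℕ → Term n → Term n
Ef zero    t         = t
Ef (suc k) (var i)   = var i
Ef (suc k) H         = H
Ef (suc k) (lam U)   = lam (Ef k U)
Ef (suc k) (app H V) = Ef k V
Ef (suc k) (app (var i) V) = app (var i) (Ef k V)
Ef (suc k) (app (lam U) V) = app (Ef k (lam U)) (Ef k V)
Ef (suc k) (app (app U W) V) with stripH (app U W)
... | just T  = Ef k (app T V)                                  -- E(H U₁…Uₙ V) = E(U₁…Uₙ V)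
... | nothing = app (Ef k (app U W)) (Ef k V)

E : ∀ {n} → Term n → Term n
E t = Ef (size t) t

-- E is the structural map erase in which every application is rebuilt by
-- the smart constructor t · v (with H · v = v), i.e. it evaluates H as the
-- identity in head position.  Substitution can only create new H-heads where
-- a substituted variable stood; erase removes these whether the substituted
-- terms were erased beforehand or not, and erasing an already erased subterm
-- changes nothing (erase is idempotent).
module Submission where

open import Defs
open import Data.Nat using (ℕ; zero; suc; _+_; _≤_; _<_; s≤s)
open import Data.Nat.Properties using (n≤1+n; ≤-trans; ≤-refl; +-monoˡ-≤; m+n≤o⇒m≤o; m+n≤o⇒n≤o)
open import Data.Fin using (Fin; zero; suc)
open import Data.Fin.Properties using (_≟_)
open import Data.Maybe using (just; nothing)
open import Function using (_∘_)
open import Relation.Nullary using (yes; no)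
open import Relation.Binary.PropositionalEquality using (_≡_; refl; sym; trans; cong; cong₂; module ≡-Reasoning)

infixl 5 _·_

_·_ : ∀ {n} → Term n → Term n → Term n
H       · v = v
var i   · v = app (var i) v
lam t   · v = app (lam t) v
app t u · v = app (app t u) v

erase : ∀ {n} → Term n → Term n
erase (var i)   = var i
erase H         = H
erase (lam U)   = lam (erase U)
erase (app U V) = erase U · erase V

stripH-erase : ∀ {n} (t T : Term n) → stripH t ≡ just T → erase t ≡ erase T
stripH-erase (app H V) T refl = refl
stripH-erase (app (app U W) V) T eq with stripH (app U W) in e
stripH-erase (app (app U W) V) .(app T′ V) refl | just T′ =
  cong (_· erase V) (stripH-erase (app U W) T′ e)

stripH-size : ∀ {n} (t T : Term n) → stripH t ≡ just T → size T < size t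
stripH-size (app H V) T refl = n≤1+n (suc (size V))
stripH-size (app (app U W) V) T eq with stripH (app U W) in e
stripH-size (app (app U W) V) .(app T′ V) refl | just T′ =
  s≤s (+-monoˡ-≤ (size V) (stripH-size (app U W) T′ e))

stripH-nothing-· : ∀ {n} (U W : Term n) → stripH (app U W) ≡ nothing →
  ∀ v → erase (app U W) · v ≡ app (erase (app U W)) v
stripH-nothing-· (var i) W e v = refl
stripH-nothing-· (lam U) W e v = refl
stripH-nothing-· (app U₁ U₂) W e v with stripH (app U₁ U₂) in e′
stripH-nothing-· (app U₁ U₂) W () v | just _
... | nothing rewrite stripH-nothing-· U₁ U₂ e′ (erase W) = refl

Ef-erase : ∀ {n} k (t : Term n) → size t ≤ k → Ef k t ≡ erase t
Ef-erase zero (var i)   ()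
Ef-erase zero H         ()
Ef-erase zero (lam t)   ()
Ef-erase zero (app t u) ()
Ef-erase (suc k) (var i) _ = refl
Ef-erase (suc k) H       _ = refl
Ef-erase (suc k) (lam U) (s≤s p) = cong lam (Ef-erase k U p)
Ef-erase (suc k) (app H V) (s≤s p) = Ef-erase k V (m+n≤o⇒n≤o 1 p)
Ef-erase (suc k) (app (var i) V) (s≤s p) =
  cong (app (var i)) (Ef-erase k V (m+n≤o⇒n≤o 1 p))
Ef-erase (suc k) (app (lam U) V) (s≤s p) =
  cong₂ app (Ef-erase k (lam U) (m+n≤o⇒m≤o (size (lam U)) p))
            (Ef-erase k V (m+n≤o⇒n≤o (size (lam U)) p))
Ef-erase (suc k) (app (app U W) V) (s≤s p) with stripH (app U W) in e
... | just T =
  trans (Ef-erase k (app T V) (≤-trans (+-monoˡ-≤ (size V) (stripH-size (app U W) T e)) p))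
        (cong (_· erase V) (sym (stripH-erase (app U W) T e)))
... | nothing =
  trans (cong₂ app (Ef-erase k (app U W) (m+n≤o⇒m≤o (size (app U W)) p))
                   (Ef-erase k V (m+n≤o⇒n≤o (size (app U W)) p)))
        (sym (stripH-nothing-· U W e (erase V)))

E≡erase : ∀ {n} (t : Term n) → E t ≡ erase t
E≡erase t = Ef-erase (size t) t ≤-refl

erase-· : ∀ {n} (a b : Term n) → erase (a · b) ≡ erase a · erase b
erase-· H         b = refl
erase-· (var i)   b = refl
erase-· (lam a)   b = refl
erase-· (app a c) b = refl

erase-idem : ∀ {n} (t : Term n) → erase (erase t) ≡ erase t
erase-idem (var i)   = refl
erase-idem H         = refl
erase-idem (lam t)   = cong lam (erase-idem t)
erase-idem (app U V) = trans (erase-· (erase U) (erase V)) (cong₂ _·_ (erase-idem U) (erase-idem V))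

rename-· : ∀ {n m} (ρ : Fin n → Fin m) (a b : Term n) → rename ρ (a · b) ≡ rename ρ a · rename ρ b
rename-· ρ H         b = refl
rename-· ρ (var i)   b = refl
rename-· ρ (lam a)   b = refl
rename-· ρ (app a c) b = refl

erase-rename : ∀ {n m} (ρ : Fin n → Fin m) (t : Term n) → erase (rename ρ t) ≡ rename ρ (erase t)
erase-rename ρ (var i)   = refl
erase-rename ρ H         = refl
erase-rename ρ (lam t)   = cong lam (erase-rename (ext ρ) t)
erase-rename ρ (app U V) =
  trans (cong₂ _·_ (erase-rename ρ U) (erase-rename ρ V)) (sym (rename-· ρ (erase U) (erase V)))

exts-cong : ∀ {n m} {σ τ : Fin n → Term m} → (∀ i → σ i ≡ τ i) → ∀ i → exts σ i ≡ exts τ i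
exts-cong h zero    = refl
exts-cong h (suc i) = cong (rename suc) (h i)

subst-cong : ∀ {n m} {σ τ : Fin n → Term m} → (∀ i → σ i ≡ τ i) → ∀ t → subst σ t ≡ subst τ t
subst-cong h (var i)   = h i
subst-cong h H         = refl
subst-cong h (lam t)   = cong lam (subst-cong (exts-cong h) t)
subst-cong h (app U V) = cong₂ app (subst-cong h U) (subst-cong h V)

erase-exts : ∀ {n m} (σ : Fin n → Term m) → ∀ i → erase (exts σ i) ≡ exts (erase ∘ σ) i
erase-exts σ zero    = refl
erase-exts σ (suc i) = erase-rename suc (σ i)

erase-subst-· : ∀ {n m} (σ : Fin n → Term m) (a b : Term n) →
  erase (subst σ (a · b)) ≡ erase (subst σ a) · erase (subst σ b)
erase-subst-· σ H         b = refl
erase-subst-· σ (var i)   b = refl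
erase-subst-· σ (lam a)   b = refl
erase-subst-· σ (app a c) b = refl

erase-subst : ∀ {n m} (σ : Fin n → Term m) (U : Term n) →
  erase (subst σ U) ≡ erase (subst (erase ∘ σ) (erase U))
erase-subst σ (var i)   = sym (erase-idem (σ i))
erase-subst σ H         = refl
erase-subst σ (lam U)   =
  cong lam (trans (erase-subst (exts σ) U) (cong erase (subst-cong (erase-exts σ) (erase U))))
erase-subst σ (app U V) =
  trans (cong₂ _·_ (erase-subst σ U) (erase-subst σ V))
        (sym (erase-subst-· (erase ∘ σ) (erase U) (erase V)))

erase-single : ∀ {n} (x : Fin n) (V : Term n) → ∀ y → erase (single x V y) ≡ single x (erase V) y
erase-single x V y with x ≟ y
... | yes _ = refl
... | no  _ = refl

lemma3p4 : (n : ℕ) (U V : Term n) (x : Fin n) →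
    E (U [ V / x ]) ≡ E ((E U) [ E V / x ])
lemma3p4 n U V x = begin
  E (U [ V / x ])                                 ≡⟨ E≡erase (U [ V / x ]) ⟩
  erase (subst (single x V) U)                    ≡⟨ erase-subst (single x V) U ⟩
  erase (subst (erase ∘ single x V) (erase U))    ≡⟨ cong erase (subst-cong (erase-single x V) (erase U)) ⟩
  erase ((erase U) [ erase V / x ])               ≡⟨ sym (E≡erase ((erase U) [ erase V / x ])) ⟩
  E ((erase U) [ erase V / x ])                   ≡⟨ cong₂ (λ s t → E (s [ t / x ])) (E≡erase U) (E≡erase V) ⟨
  E ((E U) [ E V / x ])                           ∎
  where open ≡-Reasoning
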